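{- Let $x \ge 1$ and $y \ge 1$ be integers with $2^x > 3^y$, and let $0 = \sigma_0 < \sigma_1 < \cdots < \sigma_{y-1} < x$ be integers. Let $n_0 = (2^x - 3^y)^{ -1} \sum_{k=0}^{y-1} 3^{y-1-k} 2^{\sigma_k} \in \mathbb{Z}_2$. Define $T_2 : \mathbb{Z}_2 \setminus \{0\} \to \mathbb{Z}_2$ by $T_2(n) = n/2$ if $v_2(n) > 0$ and $T_2(n) = (3n+1)/2^{v_2(3n+1)}$ if $v_2(n) = 0$. Then $n_0 \in \mathbb{Z}_2 \setminus \{0\}$ and $n_0$ is a periodic point of $T_2$, i.e. $T_2^{p}(n_0) = n_0$ for some integer $p \ge 1$.
   Context: $\mathbb{Z}_2$ is the ring of $2$-adic integers and $v_2$ the $2$-adic valuation. $2^x - 3^y$ is odd, hence a unit in $\mathbb{Z}_2$. -}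

module Defs where

open import Data.Bool using (Bool; true; false; if_then_else_; _∧_; not)
open import Data.Nat as ℕ using (ℕ; zero; suc; _∸_; _<_; _>_; >-nonZero; _≡ᵇ_)
open import Data.Nat.Divisibility using (_∣?_)
open import Data.Nat.Properties using (m<n⇒0<n∸m)
open import Data.Integer using (ℤ; +_; ∣_∣)
open import Data.Rational using (ℚ; ↥_; _/_; _*_; _+_; ½; 1ℚ)
open import Data.List using (List; map; upTo)
open import Data.Nat.ListAction using (sum)
open import Relation.Nullary using (does)

-- 2-adic valuation of a natural number (v2 0 = 0 by convention; irrelevant here).
-- Fuel m suffices since v2 m < m for m ≠ 0.
v2-go : ℕ → ℕ → ℕ
v2-go zero    m = 0
v2-go (suc f) m =
  if does (2 ∣? m) ∧ not (m ≡ᵇ 0) then suc (v2-go f (m ℕ./ 2)) else 0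

v2ℕ : ℕ → ℕ
v2ℕ m = v2-go m m

-- We model ℤ₂ ∩ ℚ = {q ∈ ℚ | denominator of q odd}.  For such q ≠ 0,
-- v₂(q) = v₂(numerator q).
v2 : ℚ → ℕ
v2 q = v2ℕ ∣ ↥ q ∣

halveN : ℕ → ℚ → ℚ
halveN zero    q = q
halveN (suc k) q = halveN k q * ½

three : ℚ
three = + 3 / 1

T2 : ℚ → ℚ
T2 n = if does (2 ∣? ∣ ↥ n ∣)
         then n * ½
         else halveN (v2 (three * n + 1ℚ)) (three * n + 1ℚ)

iter : ℕ → (ℚ → ℚ) → ℚ → ℚ
iter zero    f q = q
iter (suc p) f q = f (iter p f q)

cycleSum : (y : ℕ) → (σ : ℕ → ℕ) → ℕ
cycleSum y σ = sum (map (λ k → 3 ℕ.^ (y ∸ 1 ∸ k) ℕ.* 2 ℕ.^ σ k) (upTo y))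

n0 : (x y : ℕ) → (σ : ℕ → ℕ) → 3 ℕ.^ y < 2 ℕ.^ x → ℚ
n0 x y σ h = _/_ (+ cycleSum y σ) (2 ℕ.^ x ∸ 3 ℕ.^ y) {{>-nonZero (m<n⇒0<n∸m h)}}

-- With S = Σ_{k<y} 3^(y-1-k) 2^(σ k) and D = 2^x - 3^y (odd), n₀ = S/D.  Put
-- orbit j = 3^j S + D H_j with H_j = Σ_{k<j} 3^(j-1-k) 2^(σ k); then orbit 0 = S,
-- orbit y = 2^x S and orbit (j+1) = 3 orbit j + 2^(σ j) D.  Splitting S at j rewrites orbit j as
-- 3^j (Σ_{j≤k<y} 3^(y-1-k) 2^(σ k)) + 2^x H_j; as σ increases strictly and stays below x, this is
-- 2^(σ j) times an odd number N_j.  The recurrence then reads 3 N_j + D = 2^(σ(j+1) - σ j) N_(j+1),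
-- so T₂(N_j/D) = N_(j+1)/D, because for odd D the reduced numerator of N/D has the 2-adic
-- valuation of N.  The last step gives 3 N_(y-1) + D = 2^(x - σ(y-1)) S and closes the cycle.

module Submission where

open import Data.Integer as ℤ using (+_; ∣_∣)
import Data.Integer.Properties as ℤ
open import Data.List using (_∷_; []; map; applyUpTo)
open import Data.Nat as ℕ
  using (ℕ; zero; suc; _+_; _*_; _^_; _∸_; _/_; pred; _<_; _≤_; s≤s; s≤s⁻¹; z<s; NonZero; ≢-nonZero; >-nonZero)
open import Data.Nat.Divisibility
  using (_∣_; divides; _∣?_; ∣-trans; _∣0; m∣m*n; n∣m*n; ∣m+n∣m⇒∣n; ∣m∣n⇒∣m+n)
open import Data.Nat.DivMod using (m*n/n≡m)
open import Data.Nat.GCD using (gcd; gcd[m,n]∣n)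
open import Data.Nat.ListAction using (sum)
open import Data.Nat.Primality using (euclidsLemma; prime[2])
open import Data.Nat.Properties
open import Data.Nat.Tactic.RingSolver using (solve-∀; solve)
open import Data.Product using (_×_; _,_; ∃-syntax)
open import Data.Rational using (ℚ; ↥_; ↧ₙ_; 0ℚ; toℚᵘ; ½; 1ℚ) renaming (_/_ to _/ℚ_; _*_ to _*ℚ_; _+_ to _+ℚ_)
open import Data.Rational.Properties using (toℚᵘ-injective; toℚᵘ-homo-+; toℚᵘ-homo-*; toℚᵘ-fromℚᵘ; ↥-/; ↧-/)
open import Data.Rational.Unnormalised using (mkℚᵘ; *≡*) renaming (_≃_ to _≃ᵘ_; _*_ to _*ᵘ_; _+_ to _+ᵘ_)
import Data.Rational.Unnormalised.Properties as ℚᵘ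
open import Data.Sum using (inj₁; inj₂)
open import Function using (_∘_)
open import Relation.Binary.PropositionalEquality
  using (_≡_; _≢_; refl; sym; trans; cong; cong₂; subst; module ≡-Reasoning)
open import Relation.Nullary using (¬_; contradiction)
open import Relation.Nullary.Decidable using (dec-true; dec-false; from-no)

open import Defs

n<2^n : ∀ n → n < 2 ^ n
n<2^n zero    = z<s
n<2^n (suc n) = begin-strict
  suc n          ≤⟨ n<2^n n ⟩
  2 ^ n          <⟨ m<m+n (2 ^ n) (m^n>0 2 n) ⟩
  2 ^ n + 2 ^ n  ≡⟨ cong (λ k → 2 ^ n + k) (+-identityʳ (2 ^ n)) ⟨
  2 ^ suc n      ∎
  where open ≤-Reasoning

^-monoʳ-∣ : ∀ m {a b} → a ≤ b → m ^ a ∣ m ^ b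
^-monoʳ-∣ m {a} {b} a≤b =
  divides (m ^ (b ∸ a)) (trans (cong (m ^_) (sym (m∸n+n≡m a≤b))) (^-distribˡ-+-* m (b ∸ a) a))

m^a*n≡m^b*o⇒n≡m^[b∸a]*o : ∀ m .{{_ : NonZero m}} {a b n o} → a ≤ b →
                          m ^ a * n ≡ m ^ b * o → n ≡ m ^ (b ∸ a) * o
m^a*n≡m^b*o⇒n≡m^[b∸a]*o m {a} {b} {n} {o} a≤b eq =
  *-cancelˡ-≡ n (m ^ (b ∸ a) * o) (m ^ a) {{m^n≢0 m a}} (begin
  m ^ a * n                  ≡⟨ eq ⟩
  m ^ b * o                  ≡⟨ cong (λ e → m ^ e * o) (m+[n∸m]≡n a≤b) ⟨
  m ^ (a + (b ∸ a)) * o      ≡⟨ cong (_* o) (^-distribˡ-+-* m a (b ∸ a)) ⟩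
  m ^ a * m ^ (b ∸ a) * o    ≡⟨ *-assoc (m ^ a) (m ^ (b ∸ a)) o ⟩
  m ^ a * (m ^ (b ∸ a) * o)  ∎)
  where open ≡-Reasoning

increasing-below : ∀ {n} (f : ℕ → ℕ) → (∀ k → suc k < n → f k < f (suc k)) →
                   ∀ {i j} → i < j → j < n → f i < f j
increasing-below f step {i} {suc j} i<1+j 1+j<n with m≤n⇒m<n∨m≡n (s≤s⁻¹ i<1+j)
... | inj₁ i<j  = <-trans (increasing-below f step i<j (<-trans (n<1+n j) 1+j<n)) (step j 1+j<n)
... | inj₂ refl = step i 1+j<n

Odd : ℕ → Set
Odd n = ¬ 2 ∣ n

odd-1 : Odd 1
odd-1 = from-no (2 ∣? 1)

odd-3 : Odd 3
odd-3 = from-no (2 ∣? 3)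

odd⇒≢0 : ∀ {n} → Odd n → n ≢ 0
odd⇒≢0 n-odd refl = n-odd (2 ∣0)

odd-∣ : ∀ {m n} → m ∣ n → Odd n → Odd m
odd-∣ m∣n n-odd 2∣m = n-odd (∣-trans 2∣m m∣n)

odd-* : ∀ {m n} → Odd m → Odd n → Odd (m * n)
odd-* {m} {n} m-odd n-odd 2∣mn with euclidsLemma m n prime[2] 2∣mn
... | inj₁ 2∣m = m-odd 2∣m
... | inj₂ 2∣n = n-odd 2∣n

odd-^ : ∀ {m} k → Odd m → Odd (m ^ k)
odd-^ zero    _     = odd-1
odd-^ (suc k) m-odd = odd-* m-odd (odd-^ k m-odd)

infix 4 2^_∥_
record 2^_∥_ (e n : ℕ) : Set where
  constructor oddPart
  field
    o       : ℕ
    o-odd   : Odd o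
    n≡2^e*o : n ≡ 2 ^ e * o

∥-+-∣ : ∀ {e m n} → 2^ e ∥ m → 2 ^ suc e ∣ n → 2^ e ∥ m + n
∥-+-∣ {e} (oddPart o o-odd refl) (divides r refl) = oddPart (2 * r + o) odd-2r+o (lemma (2 ^ e) o r)
  where
  odd-2r+o : Odd (2 * r + o)
  odd-2r+o 2∣2r+o = o-odd (∣m+n∣m⇒∣n 2∣2r+o (m∣m*n r))
  lemma : ∀ p o r → p * o + r * (2 * p) ≡ p * (2 * r + o)
  lemma = solve-∀

∥-*-odd : ∀ {e m o} → Odd o → 2^ e ∥ m → 2^ e ∥ o * m
∥-*-odd {e} {o = o} o-odd (oddPart b b-odd refl) = oddPart (o * b) (odd-* o-odd b-odd) (lemma o (2 ^ e) b)
  where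
  lemma : ∀ o p b → o * (p * b) ≡ p * (o * b)
  lemma = solve-∀

∥-*2 : ∀ {e m} → 2^ e ∥ m → 2^ suc e ∥ m * 2
∥-*2 {e} (oddPart b b-odd refl) = oddPart b b-odd (lemma (2 ^ e) b)
  where
  lemma : ∀ p b → p * b * 2 ≡ 2 * p * b
  lemma = solve-∀

∥-/2 : ∀ {e m} → 2^ suc e ∥ m * 2 → 2^ e ∥ m
∥-/2 {e} {m} (oddPart b b-odd eq) = oddPart b b-odd (*-cancelʳ-≡ m (2 ^ e * b) 2 (trans eq (lemma (2 ^ e) b)))
  where
  lemma : ∀ p b → 2 * p * b ≡ p * b * 2
  lemma = solve-∀

∥-cancelʳ-odd : ∀ {e a g} → Odd g → 2^ e ∥ a * g → 2^ e ∥ a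
∥-cancelʳ-odd {zero} {a} {g} g-odd (oddPart o o-odd ag≡o) = oddPart a a-odd (sym (*-identityˡ a))
  where
  a-odd : Odd a
  a-odd 2∣a = o-odd (subst (2 ∣_) (trans ag≡o (*-identityˡ o)) (∣-trans 2∣a (m∣m*n g)))
∥-cancelʳ-odd {suc e} {a} {g} g-odd e∥ag@(oddPart o _ ag≡) with euclidsLemma a g prime[2] 2∣ag
  where
  2∣ag : 2 ∣ a * g
  2∣ag = subst (2 ∣_) (sym ag≡) (∣-trans (m∣m*n (2 ^ e)) (m∣m*n o))
... | inj₂ 2∣g = contradiction 2∣g g-odd
... | inj₁ (divides a' refl) = ∥-*2 {m = a'} (∥-cancelʳ-odd g-odd (∥-/2 {m = a' * g} (subst (2^ suc e ∥_) (lemma a' g) e∥ag)))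
  where
  lemma : ∀ a' g → a' * 2 * g ≡ a' * g * 2
  lemma = solve-∀

v2-go-odd : ∀ {f m} → Odd m → v2-go (suc f) m ≡ 0
v2-go-odd {m = m} m-odd rewrite dec-false (2 ∣? m) m-odd = refl

v2-go-even : ∀ {f} m .{{_ : NonZero m}} → 2 ∣ m → v2-go (suc f) m ≡ suc (v2-go f (m / 2))
v2-go-even (suc m) 2∣m rewrite dec-true (2 ∣? suc m) 2∣m = refl

v2-go-2^*odd : ∀ {f} e {o} → e < f → Odd o → v2-go f (2 ^ e * o) ≡ e
v2-go-2^*odd {suc f} zero    {o} _          o-odd = v2-go-odd {f} (subst Odd (sym (*-identityˡ o)) o-odd)
v2-go-2^*odd {suc f} (suc e) {o} (s≤s e<f) o-odd = begin
  v2-go (suc f) (2 ^ suc e * o)      ≡⟨ v2-go-even {f} (2 ^ suc e * o) {{nonZero}} (divides (2 ^ e * o) double) ⟩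
  suc (v2-go f (2 ^ suc e * o / 2))  ≡⟨ cong (λ m → suc (v2-go f m)) half ⟩
  suc (v2-go f (2 ^ e * o))          ≡⟨ cong suc (v2-go-2^*odd {f} e e<f o-odd) ⟩
  suc e                              ∎
  where
  open ≡-Reasoning
  nonZero : NonZero (2 ^ suc e * o)
  nonZero = m*n≢0 (2 ^ suc e) o {{m^n≢0 2 (suc e)}} {{≢-nonZero (odd⇒≢0 o-odd)}}
  double : 2 ^ suc e * o ≡ 2 ^ e * o * 2
  double = trans (*-assoc 2 (2 ^ e) o) (*-comm 2 (2 ^ e * o))
  half : 2 ^ suc e * o / 2 ≡ 2 ^ e * o
  half = trans (cong (_/ 2) double) (m*n/n≡m (2 ^ e * o) 2)

v2ℕ-∥ : ∀ {e n} → 2^ e ∥ n → v2ℕ n ≡ e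
v2ℕ-∥ {e} (oddPart o o-odd refl) =
  v2-go-2^*odd e (<-≤-trans (n<2^n e) (m≤m*n (2 ^ e) o {{≢-nonZero (odd⇒≢0 o-odd)}})) o-odd

sum-map-applyUpTo-cong : ∀ {f g h i : ℕ → ℕ} n → (∀ k → f (h k) ≡ g (i k)) →
                         sum (map f (applyUpTo h n)) ≡ sum (map g (applyUpTo i n))
sum-map-applyUpTo-cong zero    _  = refl
sum-map-applyUpTo-cong (suc n) eq = cong₂ _+_ (eq 0) (sum-map-applyUpTo-cong n (eq ∘ suc))

cycleSum-suc : ∀ n τ → cycleSum (suc n) τ ≡ 3 ^ n * 2 ^ τ 0 + cycleSum n (τ ∘ suc)
cycleSum-suc n τ = cong (λ s → 3 ^ n * 2 ^ τ 0 + s) (sum-map-applyUpTo-cong n λ k →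
  cong (λ e → 3 ^ e * 2 ^ τ (suc k)) (sym (∸-+-assoc n 1 k)))

cycleSum-horner : ∀ n τ → cycleSum (suc n) τ ≡ 3 * cycleSum n τ + 2 ^ τ n
cycleSum-horner zero    τ = trans (+-identityʳ (1 * 2 ^ τ 0)) (*-identityˡ (2 ^ τ 0))
cycleSum-horner (suc n) τ = begin
  cycleSum (suc (suc n)) τ                                  ≡⟨ cycleSum-suc (suc n) τ ⟩
  3 ^ suc n * 2 ^ τ 0 + cycleSum (suc n) (τ ∘ suc)          ≡⟨ cong (λ s → 3 ^ suc n * 2 ^ τ 0 + s)
                                                                    (cycleSum-horner n (τ ∘ suc)) ⟩
  3 ^ suc n * 2 ^ τ 0 + (3 * H + 2 ^ τ (suc n))             ≡⟨ lemma (3 ^ n) (2 ^ τ 0) H (2 ^ τ (suc n)) ⟩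
  3 * (3 ^ n * 2 ^ τ 0 + H) + 2 ^ τ (suc n)                 ≡⟨ cong (λ s → 3 * s + 2 ^ τ (suc n)) (cycleSum-suc n τ) ⟨
  3 * cycleSum (suc n) τ + 2 ^ τ (suc n)                    ∎
  where
  open ≡-Reasoning
  H : ℕ
  H = cycleSum n (τ ∘ suc)
  lemma : ∀ a p h q → 3 * a * p + (3 * h + q) ≡ 3 * (a * p + h) + q
  lemma = solve-∀

cycleSum-+ : ∀ m n τ → cycleSum (m + n) τ ≡ 3 ^ n * cycleSum m τ + cycleSum n (λ k → τ (m + k))
cycleSum-+ zero    n τ = sym (cong (λ s → s + cycleSum n τ) (*-zeroʳ (3 ^ n)))
cycleSum-+ (suc m) n τ = begin
  cycleSum (suc (m + n)) τ                             ≡⟨ cycleSum-suc (m + n) τ ⟩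
  3 ^ (m + n) * 2 ^ τ 0 + cycleSum (m + n) (τ ∘ suc)   ≡⟨ cong₂ _+_ (cong (_* 2 ^ τ 0) (^-distribˡ-+-* 3 m n))
                                                                    (cycleSum-+ m n (τ ∘ suc)) ⟩
  3 ^ m * 3 ^ n * 2 ^ τ 0 + (3 ^ n * H + T)            ≡⟨ lemma (3 ^ m) (3 ^ n) (2 ^ τ 0) H T ⟩
  3 ^ n * (3 ^ m * 2 ^ τ 0 + H) + T                    ≡⟨ cong (λ s → 3 ^ n * s + T) (cycleSum-suc m τ) ⟨
  3 ^ n * cycleSum (suc m) τ + T                       ∎
  where
  open ≡-Reasoning
  H T : ℕ
  H = cycleSum m (τ ∘ suc)
  T = cycleSum n (λ k → τ (suc m + k))
  lemma : ∀ a b p h t → a * b * p + (b * h + t) ≡ b * (a * p + h) + t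
  lemma = solve-∀

2^∣cycleSum : ∀ {a} n τ → (∀ k → k < n → a ≤ τ k) → 2 ^ a ∣ cycleSum n τ
2^∣cycleSum {a} zero    τ _     = (2 ^ a) ∣0
2^∣cycleSum {a} (suc n) τ a≤τ = subst (2 ^ a ∣_) (sym (cycleSum-suc n τ))
  (∣m∣n⇒∣m+n (∣-trans (^-monoʳ-∣ 2 (a≤τ 0 z<s)) (n∣m*n (3 ^ n)))
             (2^∣cycleSum n (τ ∘ suc) (λ k k<n → a≤τ (suc k) (s≤s k<n))))

∥-cycleSum : ∀ n τ → 0 < n → (∀ k → suc k < n → τ 0 < τ (suc k)) → 2^ τ 0 ∥ cycleSum n τ
∥-cycleSum (suc n) τ _ τ0<τ = subst (2^ τ 0 ∥_) (sym (cycleSum-suc n τ))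
  (∥-+-∣ (∥-*-odd (odd-^ n odd-3) (oddPart 1 odd-1 (sym (*-identityʳ (2 ^ τ 0)))))
         (2^∣cycleSum n (τ ∘ suc) (λ k k<n → τ0<τ k (s≤s k<n))))

∣↥[m/n]∣*gcd≡m : ∀ m n .{{_ : NonZero n}} → ∣ ↥ (+ m /ℚ n) ∣ * gcd m n ≡ m
∣↥[m/n]∣*gcd≡m m n = trans (sym (ℤ.abs-* (↥ (+ m /ℚ n)) (+ gcd m n))) (cong ∣_∣ (↥-/ (+ m) n))

↧ₙ[m/n]*gcd≡n : ∀ m n .{{_ : NonZero n}} → ↧ₙ (+ m /ℚ n) * gcd m n ≡ n
↧ₙ[m/n]*gcd≡n m n = trans (sym (ℤ.abs-* (+ ↧ₙ (+ m /ℚ n)) (+ gcd m n))) (cong ∣_∣ (↧-/ (+ m) n))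

odd-↥ : ∀ {m} n .{{_ : NonZero n}} → Odd m → Odd ∣ ↥ (+ m /ℚ n) ∣
odd-↥ {m} n = odd-∣ (subst (∣ ↥ (+ m /ℚ n) ∣ ∣_) (∣↥[m/n]∣*gcd≡m m n) (m∣m*n (gcd m n)))

odd-↧ₙ : ∀ m {n} .{{_ : NonZero n}} → Odd n → Odd (↧ₙ (+ m /ℚ n))
odd-↧ₙ m {n} = odd-∣ (subst (↧ₙ (+ m /ℚ n) ∣_) (↧ₙ[m/n]*gcd≡n m n) (m∣m*n (gcd m n)))

v2-/ : ∀ {e} m n .{{_ : NonZero n}} → Odd n → 2^ e ∥ m → v2 (+ m /ℚ n) ≡ e
v2-/ {e} m n n-odd e∥m = v2ℕ-∥ (∥-cancelʳ-odd {a = ∣ ↥ (+ m /ℚ n) ∣} {g = gcd m n} (odd-∣ (gcd[m,n]∣n m n) n-odd)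
                                 (subst (2^ e ∥_) (sym (∣↥[m/n]∣*gcd≡m m n)) e∥m))

/-≢0 : ∀ {m} n .{{_ : NonZero n}} → m ≢ 0 → + m /ℚ n ≢ 0ℚ
/-≢0 {m} n m≢0 m/n≡0 = m≢0 (trans (sym (∣↥[m/n]∣*gcd≡m m n)) (cong (λ q → ∣ ↥ q ∣ * gcd m n) m/n≡0))

mkℚᵘ-≃ : ∀ {a b} d e → a * suc e ≡ b * suc d → mkℚᵘ (+ a) d ≃ᵘ mkℚᵘ (+ b) e
mkℚᵘ-≃ {a} {b} d e eq = *≡* (begin
  + a ℤ.* + suc e  ≡⟨ ℤ.pos-* a (suc e) ⟨
  + (a * suc e)    ≡⟨ cong +_ eq ⟩
  + (b * suc d)    ≡⟨ ℤ.pos-* b (suc d) ⟩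
  + b ℤ.* + suc d  ∎)
  where open ≡-Reasoning

mkℚᵘ-* : ∀ a b d e → mkℚᵘ (+ a) d *ᵘ mkℚᵘ (+ b) e ≃ᵘ mkℚᵘ (+ (a * b)) (e + d * suc e)
mkℚᵘ-* a b d e = *≡* (cong (ℤ._* + suc (e + d * suc e)) (sym (ℤ.pos-* a b)))

mkℚᵘ-+ : ∀ a b d e → mkℚᵘ (+ a) d +ᵘ mkℚᵘ (+ b) e ≃ᵘ mkℚᵘ (+ (a * suc e + b * suc d)) (e + d * suc e)
mkℚᵘ-+ a b d e = *≡* (cong (ℤ._* + suc (e + d * suc e)) (sym (cong₂ ℤ._+_ (ℤ.pos-* a (suc e)) (ℤ.pos-* b (suc d)))))

three*[m/n]+1 : ∀ m n .{{_ : NonZero n}} → three *ℚ (+ m /ℚ n) +ℚ 1ℚ ≡ + (3 * m + n) /ℚ n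
three*[m/n]+1 m (suc d) = toℚᵘ-injective (begin
  toℚᵘ (three *ℚ (+ m /ℚ suc d) +ℚ 1ℚ)
    ≈⟨ toℚᵘ-homo-+ (three *ℚ (+ m /ℚ suc d)) 1ℚ ⟩
  toℚᵘ (three *ℚ (+ m /ℚ suc d)) +ᵘ mkℚᵘ (+ 1) 0
    ≈⟨ ℚᵘ.+-congˡ (mkℚᵘ (+ 1) 0) (toℚᵘ-homo-* three (+ m /ℚ suc d)) ⟩
  mkℚᵘ (+ 3) 0 *ᵘ toℚᵘ (+ m /ℚ suc d) +ᵘ mkℚᵘ (+ 1) 0
    ≈⟨ ℚᵘ.+-congˡ (mkℚᵘ (+ 1) 0) (ℚᵘ.*-congˡ {mkℚᵘ (+ 3) 0} (toℚᵘ-fromℚᵘ (mkℚᵘ (+ m) d))) ⟩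
  mkℚᵘ (+ 3) 0 *ᵘ mkℚᵘ (+ m) d +ᵘ mkℚᵘ (+ 1) 0
    ≈⟨ ℚᵘ.+-congˡ (mkℚᵘ (+ 1) 0) (mkℚᵘ-* 3 m 0 d) ⟩
  mkℚᵘ (+ (3 * m)) (d + 0) +ᵘ mkℚᵘ (+ 1) 0
    ≈⟨ mkℚᵘ-+ (3 * m) 1 (d + 0) 0 ⟩
  mkℚᵘ (+ (3 * m * 1 + 1 * suc (d + 0))) (0 + (d + 0) * 1)
    ≈⟨ mkℚᵘ-≃ _ d (solve (m ∷ d ∷ [])) ⟩
  mkℚᵘ (+ (3 * m + suc d)) d
    ≈⟨ ℚᵘ.≃-sym (toℚᵘ-fromℚᵘ (mkℚᵘ (+ (3 * m + suc d)) d)) ⟩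
  toℚᵘ (+ (3 * m + suc d) /ℚ suc d) ∎)
  where open ℚᵘ.≃-Reasoning

[2m/n]*½ : ∀ m n .{{_ : NonZero n}} → (+ (2 * m) /ℚ n) *ℚ ½ ≡ + m /ℚ n
[2m/n]*½ m (suc d) = toℚᵘ-injective (begin
  toℚᵘ ((+ (2 * m) /ℚ suc d) *ℚ ½)
    ≈⟨ toℚᵘ-homo-* (+ (2 * m) /ℚ suc d) ½ ⟩
  toℚᵘ (+ (2 * m) /ℚ suc d) *ᵘ mkℚᵘ (+ 1) 1
    ≈⟨ ℚᵘ.*-congʳ {mkℚᵘ (+ 1) 1} (toℚᵘ-fromℚᵘ (mkℚᵘ (+ (2 * m)) d)) ⟩
  mkℚᵘ (+ (2 * m)) d *ᵘ mkℚᵘ (+ 1) 1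
    ≈⟨ mkℚᵘ-* (2 * m) 1 d 1 ⟩
  mkℚᵘ (+ (2 * m * 1)) (1 + d * 2)
    ≈⟨ mkℚᵘ-≃ _ d (solve (m ∷ d ∷ [])) ⟩
  mkℚᵘ (+ m) d
    ≈⟨ ℚᵘ.≃-sym (toℚᵘ-fromℚᵘ (mkℚᵘ (+ m) d)) ⟩
  toℚᵘ (+ m /ℚ suc d) ∎)
  where open ℚᵘ.≃-Reasoning

halveN-[2^e*m/n] : ∀ e m n .{{_ : NonZero n}} → halveN e (+ (2 ^ e * m) /ℚ n) ≡ + m /ℚ n
halveN-[2^e*m/n] zero    m n = cong (λ k → + k /ℚ n) (*-identityˡ m)
halveN-[2^e*m/n] (suc e) m n = begin
  halveN e (+ (2 ^ suc e * m) /ℚ n) *ℚ ½    ≡⟨ cong (λ k → halveN e (+ k /ℚ n) *ℚ ½) (lemma (2 ^ e) m) ⟩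
  halveN e (+ (2 ^ e * (2 * m)) /ℚ n) *ℚ ½  ≡⟨ cong (_*ℚ ½) (halveN-[2^e*m/n] e (2 * m) n) ⟩
  (+ (2 * m) /ℚ n) *ℚ ½                     ≡⟨ [2m/n]*½ m n ⟩
  + m /ℚ n                                  ∎
  where
  open ≡-Reasoning
  lemma : ∀ p m → 2 * p * m ≡ p * (2 * m)
  lemma = solve-∀

T2-odd : ∀ q → Odd ∣ ↥ q ∣ → T2 q ≡ halveN (v2 (three *ℚ q +ℚ 1ℚ)) (three *ℚ q +ℚ 1ℚ)
T2-odd q ↥q-odd rewrite dec-false (2 ∣? ∣ ↥ q ∣) ↥q-odd = refl

T2-[m/n] : ∀ {m m' e} n .{{_ : NonZero n}} → Odd n → Odd m → Odd m' →
           3 * m + n ≡ 2 ^ e * m' → T2 (+ m /ℚ n) ≡ + m' /ℚ n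
T2-[m/n] {m} {m'} {e} n n-odd m-odd m'-odd 3m+n≡ = begin
  T2 (+ m /ℚ n)
    ≡⟨ T2-odd (+ m /ℚ n) (odd-↥ n m-odd) ⟩
  halveN (v2 (three *ℚ (+ m /ℚ n) +ℚ 1ℚ)) (three *ℚ (+ m /ℚ n) +ℚ 1ℚ)
    ≡⟨ cong (λ q → halveN (v2 q) q) (trans (three*[m/n]+1 m n) (cong (λ k → + k /ℚ n) 3m+n≡)) ⟩
  halveN (v2 (+ (2 ^ e * m') /ℚ n)) (+ (2 ^ e * m') /ℚ n)
    ≡⟨ cong (λ k → halveN k (+ (2 ^ e * m') /ℚ n)) (v2-/ {e} (2 ^ e * m') n n-odd (oddPart m' m'-odd refl)) ⟩
  halveN e (+ (2 ^ e * m') /ℚ n)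
    ≡⟨ halveN-[2^e*m/n] e m' n ⟩
  + m' /ℚ n ∎
  where open ≡-Reasoning

module Cycle (x y : ℕ) (σ : ℕ → ℕ) (3^y<2^x : 3 ^ y < 2 ^ x) (1≤x : 1 ≤ x) (σ0≡0 : σ 0 ≡ 0)
             (σ-step : ∀ k → suc k < y → σ k < σ (suc k)) (σ<x : ∀ k → k < y → σ k < x) where

  D : ℕ
  D = 2 ^ x ∸ 3 ^ y

  instance
    D≢0 : NonZero D
    D≢0 = >-nonZero (m<n⇒0<n∸m 3^y<2^x)

  D+3^y≡2^x : D + 3 ^ y ≡ 2 ^ x
  D+3^y≡2^x = m∸n+n≡m (<⇒≤ 3^y<2^x)

  D-odd : Odd D
  D-odd 2∣D = odd-^ y odd-3 (∣m+n∣m⇒∣n (subst (2 ∣_) (sym D+3^y≡2^x) 2∣2^x) 2∣D)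
    where
    2∣2^x : 2 ∣ 2 ^ x
    2∣2^x = ∣-trans (m∣m*n 1) (^-monoʳ-∣ 2 1≤x)

  S : ℕ
  S = cycleSum y σ

  n₀ : ℚ
  n₀ = + S /ℚ D

  orbit : ℕ → ℕ
  orbit j = 3 ^ j * S + D * cycleSum j σ

  orbit-zero : orbit 0 ≡ S
  orbit-zero = lemma S D
    where
    lemma : ∀ s d → 1 * s + d * 0 ≡ s
    lemma = solve-∀

  orbit-suc : ∀ j → orbit (suc j) ≡ 3 * orbit j + 2 ^ σ j * D
  orbit-suc j = begin
    3 ^ suc j * S + D * cycleSum (suc j) σ            ≡⟨ cong (λ h → 3 ^ suc j * S + D * h) (cycleSum-horner j σ) ⟩
    3 * 3 ^ j * S + D * (3 * cycleSum j σ + 2 ^ σ j)  ≡⟨ lemma (3 ^ j) S D (cycleSum j σ) (2 ^ σ j) ⟩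
    3 * orbit j + 2 ^ σ j * D                         ∎
    where
    open ≡-Reasoning
    lemma : ∀ a s d h p → 3 * a * s + d * (3 * h + p) ≡ 3 * (a * s + d * h) + p * d
    lemma = solve-∀

  orbit-y : orbit y ≡ 2 ^ x * S
  orbit-y = trans (sym (*-distribʳ-+ S (3 ^ y) D)) (cong (_* S) (trans (+-comm (3 ^ y) D) D+3^y≡2^x))

  orbit-tail : ∀ j → j ≤ y → orbit j ≡ 3 ^ j * cycleSum (y ∸ j) (λ k → σ (j + k)) + 2 ^ x * cycleSum j σ
  orbit-tail j j≤y = begin
    3 ^ j * S + D * H                          ≡⟨ cong (λ s → 3 ^ j * s + D * H) S-split ⟩
    3 ^ j * (3 ^ (y ∸ j) * H + T) + D * H      ≡⟨ lemma (3 ^ j) (3 ^ (y ∸ j)) H T D ⟩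
    3 ^ j * T + (D + 3 ^ j * 3 ^ (y ∸ j)) * H  ≡⟨ cong (λ p → 3 ^ j * T + (D + p) * H) 3^j*3^[y∸j]≡3^y ⟩
    3 ^ j * T + (D + 3 ^ y) * H                ≡⟨ cong (λ p → 3 ^ j * T + p * H) D+3^y≡2^x ⟩
    3 ^ j * T + 2 ^ x * H                      ∎
    where
    open ≡-Reasoning
    H T : ℕ
    H = cycleSum j σ
    T = cycleSum (y ∸ j) (λ k → σ (j + k))
    S-split : S ≡ 3 ^ (y ∸ j) * H + T
    S-split = trans (cong (λ n → cycleSum n σ) (sym (m+[n∸m]≡n j≤y))) (cycleSum-+ j (y ∸ j) σ)
    3^j*3^[y∸j]≡3^y : 3 ^ j * 3 ^ (y ∸ j) ≡ 3 ^ y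
    3^j*3^[y∸j]≡3^y = trans (sym (^-distribˡ-+-* 3 j (y ∸ j))) (cong (3 ^_) (m+[n∸m]≡n j≤y))
    lemma : ∀ a b h t d → a * (b * h + t) + d * h ≡ a * t + (d + a * b) * h
    lemma = solve-∀

  orbit-∥ : ∀ j → j < y → 2^ σ j ∥ orbit j
  orbit-∥ j j<y = subst (2^ σ j ∥_) (sym (orbit-tail j (<⇒≤ j<y)))
    (∥-+-∣ (∥-*-odd (odd-^ j odd-3) tail-∥) (∣-trans (^-monoʳ-∣ 2 (σ<x j j<y)) (m∣m*n (cycleSum j σ))))
    where
    σ-gap : ∀ k → suc k < y ∸ j → σ (j + 0) < σ (j + suc k)
    σ-gap k 1+k<y∸j = increasing-below σ σ-step (+-monoʳ-< j z<s)
      (subst (_< y) (+-comm (suc k) j) (m≤o∸n⇒m+n≤o (suc (suc k)) (<⇒≤ j<y) 1+k<y∸j))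
    tail-∥ : 2^ σ j ∥ cycleSum (y ∸ j) (λ k → σ (j + k))
    tail-∥ = subst (λ i → 2^ σ i ∥ cycleSum (y ∸ j) (λ k → σ (j + k))) (+-identityʳ j)
      (∥-cycleSum (y ∸ j) (λ k → σ (j + k)) (m<n⇒0<n∸m j<y) σ-gap)

  orbit0≡2^σ0*N⇒S≡N : ∀ {N} → orbit 0 ≡ 2 ^ σ 0 * N → S ≡ N
  orbit0≡2^σ0*N⇒S≡N {N} orbit-0≡ =
    trans (sym orbit-zero) (trans orbit-0≡ (trans (cong (λ e → 2 ^ e * N) σ0≡0) (*-identityˡ N)))

  S-odd : 0 < y → Odd S
  S-odd 0<y = subst Odd (sym (orbit0≡2^σ0*N⇒S≡N n≡2^e*o)) o-odd
    where open 2^_∥_ (orbit-∥ 0 0<y)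

  T2-orbit : ∀ {j s N N'} → Odd N → orbit j ≡ 2 ^ σ j * N → Odd N' → orbit (suc j) ≡ 2 ^ s * N' →
             σ j ≤ s → T2 (+ N /ℚ D) ≡ + N' /ℚ D
  T2-orbit {j} {s} {N} {N'} N-odd orbit-j≡ N'-odd orbit-1+j≡ σj≤s =
    T2-[m/n] {e = s ∸ σ j} D D-odd N-odd N'-odd (m^a*n≡m^b*o⇒n≡m^[b∸a]*o 2 σj≤s (begin
      2 ^ σ j * (3 * N + D)            ≡⟨ lemma (2 ^ σ j) N D ⟩
      3 * (2 ^ σ j * N) + 2 ^ σ j * D  ≡⟨ cong (λ o → 3 * o + 2 ^ σ j * D) orbit-j≡ ⟨
      3 * orbit j + 2 ^ σ j * D        ≡⟨ orbit-suc j ⟨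
      orbit (suc j)                    ≡⟨ orbit-1+j≡ ⟩
      2 ^ s * N'                       ∎))
    where
    open ≡-Reasoning
    lemma : ∀ p n d → p * (3 * n + d) ≡ 3 * (p * n) + p * d
    lemma = solve-∀

  iter-T2 : ∀ j → j < y → ∀ {N} → Odd N → orbit j ≡ 2 ^ σ j * N → iter j T2 n₀ ≡ + N /ℚ D
  iter-T2 zero    _     _     orbit-0≡   = cong (λ k → + k /ℚ D) (orbit0≡2^σ0*N⇒S≡N orbit-0≡)
  iter-T2 (suc j) 1+j<y N-odd orbit-1+j≡ =
    trans (cong T2 (iter-T2 j j<y o-odd n≡2^e*o))
          (T2-orbit o-odd n≡2^e*o N-odd orbit-1+j≡ (<⇒≤ (σ-step j 1+j<y)))
    where
    j<y : j < y
    j<y = <-trans (n<1+n j) 1+j<y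
    open 2^_∥_ (orbit-∥ j j<y)

  T2-closes-cycle : ∀ j → suc j ≡ y → T2 (iter j T2 n₀) ≡ n₀
  T2-closes-cycle j 1+j≡y =
    trans (cong T2 (iter-T2 j j<y o-odd n≡2^e*o))
          (T2-orbit o-odd n≡2^e*o (S-odd 0<y) (trans (cong orbit 1+j≡y) orbit-y) (<⇒≤ (σ<x j j<y)))
    where
    j<y : j < y
    j<y = subst (j <_) 1+j≡y (n<1+n j)
    0<y : 0 < y
    0<y = subst (0 <_) 1+j≡y z<s
    open 2^_∥_ (orbit-∥ j j<y)

  n₀-periodic : 1 ≤ y → iter y T2 n₀ ≡ n₀
  n₀-periodic 1≤y = subst (λ p → iter p T2 n₀ ≡ n₀) 1+j≡y (T2-closes-cycle (pred y) 1+j≡y)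
    where
    1+j≡y : suc (pred y) ≡ y
    1+j≡y = suc-pred y {{>-nonZero 1≤y}}

corollary6p3 : (x y : ℕ) → 1 ≤ x → 1 ≤ y → (h : 3 ^ y < 2 ^ x)
  → (σ : ℕ → ℕ) → σ 0 ≡ 0
  → (∀ k → suc k < y → σ k < σ (suc k))
  → (∀ k → k < y → σ k < x)
  → (¬ (2 ∣ ↧ₙ (n0 x y σ h)) × n0 x y σ h ≢ 0ℚ)
    × (∃[ p ] (1 ≤ p × iter p T2 (n0 x y σ h) ≡ n0 x y σ h))
corollary6p3 x y 1≤x 1≤y 3^y<2^x σ σ0≡0 σ-step σ<x =
  (odd-↧ₙ S D-odd , /-≢0 D (odd⇒≢0 (S-odd 1≤y))) , y , 1≤y , n₀-periodic 1≤y
  where open Cycle x y σ 3^y<2^x 1≤x σ0≡0 σ-step σ<x
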